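{- For all integers $t,d\ge 2$, every $K_{2,t}$-free graph of minimum degree $d$ contains induced cycles of at least $\lceil\frac{d-1}{t-1}\rceil$ distinct lengths, and in particular contains an induced cycle of length at least $2+\lceil\frac{d-1}{t-1}\rceil$.
   Context: Graphs are finite and simple. A graph is $K_{2,t}$-free if it has no (not necessarily induced) subgraph isomorphic to the complete bipartite graph $K_{2,t}$. -}

module Defs where

open import Data.Nat using (ℕ; zero; suc; _+_; _∸_; _≤_; _/_)
open import Data.Bool using (Bool; true; false)
import Data.Bool as B
open import Data.Fin using (Fin; toℕ)
open import Data.Sum using (_⊎_)
open import Data.Product using (_×_; Σ; ∃; ∃-syntax)
open import Data.List using (List; length; filter; allFin)
open import Relation.Binary.PropositionalEquality using (_≡_; _≢_)
open import Function.Definitions using (Injective)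
open import Function.Bundles using (_⇔_)

record Graph : Set where
  field
    n      : ℕ
    adj    : Fin n → Fin n → Bool
    sym    : ∀ u v → adj u v ≡ adj v u
    irrefl : ∀ v → adj v v ≡ false

open Graph public

Adj : (G : Graph) → Fin (n G) → Fin (n G) → Set
Adj G u v = adj G u v ≡ true

degree : (G : Graph) → Fin (n G) → ℕ
degree G v = length (filter (λ u → adj G v u B.≟ true) (allFin (n G)))

MinDegree : Graph → ℕ → Set
MinDegree G d = (∀ v → d ≤ degree G v) × (∃[ v ] degree G v ≡ d)

-- K_{2,t} as a (not necessarily induced) subgraph: an injective map from
-- the vertex set Fin 2 ⊎ Fin t of K_{2,t} into G sending every edge
-- (between the two sides) to an edge of G.
ContainsK2t : Graph → ℕ → Set
ContainsK2t G t =
  Σ (Fin 2 ⊎ Fin t → Fin (n G)) λ f →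
    Injective _≡_ _≡_ f ×
    (∀ (i : Fin 2) (j : Fin t) → Adj G (f (Data.Sum.inj₁ i)) (f (Data.Sum.inj₂ j)))

K2tFree : Graph → ℕ → Set
K2tFree G t = ContainsK2t G t → Data.Empty.⊥
  where import Data.Empty

CycAdj : (k : ℕ) → Fin k → Fin k → Set
CycAdj k i j =
  (toℕ j ≡ suc (toℕ i)) ⊎ (toℕ i ≡ suc (toℕ j)) ⊎
  ((toℕ i ≡ 0 × suc (toℕ j) ≡ k) ⊎ (toℕ j ≡ 0 × suc (toℕ i) ≡ k))

HasInducedCycle : Graph → ℕ → Set
HasInducedCycle G k =
  3 ≤ k ×
  Σ (Fin k → Fin (n G)) λ f →
    Injective _≡_ _≡_ f ×
    (∀ i j → Adj G (f i) (f j) ⇔ CycAdj k i j)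

-- ⌈ a / b ⌉ for b ≥ 1 (value at b = 0 is irrelevant, set to 0)
ceilDiv : ℕ → ℕ → ℕ
ceilDiv a zero    = 0
ceilDiv a (suc b) = (a + b) / suc b

module Submission where

-- Take a maximal induced path x = p₀, p₁, …, pₘ, maximal in the sense that it cannot be
-- prolonged beyond x. Every neighbour u ≠ p₁ of x (a far neighbour) is off the path and,
-- by maximality, adjacent to some of p₁ … pₘ; let p_ℓ be the first of them, the contact
-- of u. Then x p₁ … p_ℓ u is an induced cycle of length ℓ + 2. The far neighbours with a
-- common contact ℓ are common neighbours of x and p_ℓ, so there are at most t - 1 of them.
-- Hence d - 1 ≤ deg x - 1 ≤ (t - 1)·L, where L is the number of distinct contacts, which
-- gives ⌈(d-1)/(t-1)⌉ ≤ L distinct cycle lengths; and L distinct positive contacts include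
-- one that is at least L, giving a cycle of length at least L + 2.

open import Defs hiding (sym)
open import Data.Nat using (ℕ; zero; suc; _+_; _*_; _∸_; _≤_; _<_; z≤n; s≤s; s≤s⁻¹; _≤?_)
open import Data.Nat.Properties
open import Data.Nat.DivMod using (m<n*o⇒m/o<n)
open import Data.Bool using (true)
import Data.Bool as Bool
open import Data.Fin using (Fin; toℕ; inject≤; fromℕ<) renaming (zero to fzero; suc to fsuc; _≟_ to _≟ᶠ_)
open import Data.Fin.Properties using (toℕ-injective; toℕ<n; inject≤-injective; injective⇒≤; any?)
open import Data.Sum using (_⊎_; inj₁; inj₂)
open import Data.Product using (_×_; _,_; proj₁; proj₂; Σ; ∃; ∃-syntax)
open import Data.List using (List; []; _∷_; length; filter; allFin; lookup; map; deduplicate; applyUpTo)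
open import Data.List.Properties using (length-applyUpTo; length-map; filter-none)
open import Data.List.Membership.Propositional using (_∈_)
open import Data.List.Membership.Propositional.Properties
  using (∈-filter⁻; ∈-lookup; ∈-map⁺; ∈-map⁻; ∈-deduplicate⁺; ∈-deduplicate⁻; ∈-applyUpTo⁺)
open import Data.List.Relation.Unary.All as All using (All; []; _∷_)
open import Data.List.Relation.Unary.All.Properties using (¬Any⇒All¬)
import Data.List.Relation.Unary.All.Properties as All
open import Data.List.Relation.Unary.Any using (Any; here; there)
import Data.List.Relation.Unary.Any as Any
open import Data.List.Relation.Unary.AllPairs using ([]; _∷_)
open import Data.List.Relation.Unary.Unique.Propositional using (Unique)
open import Data.List.Relation.Unary.Unique.Propositional.Properties as Unique using (allFin⁺)
open import Data.List.Relation.Unary.Unique.DecPropositional.Properties using (deduplicate-!)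
import Data.List.Relation.Binary.Sublist.Propositional.Properties as Sublist
open import Function using (_∘_; Injective; mk⇔)
open import Relation.Nullary using (¬_; Dec; yes; no; ¬?; contradiction)
open import Relation.Nullary.Decidable using (map′; _×-dec_)
open import Relation.Binary.Definitions using (DecidableEquality)
open import Relation.Binary.PropositionalEquality using (_≡_; _≢_; refl; sym; trans; cong; subst; subst₂)

length-split : ∀ {A : Set} {P : A → Set} (P? : ∀ a → Dec (P a)) (xs : List A) →
  length xs ≡ length (filter P? xs) + length (filter (¬? ∘ P?) xs)
length-split P? [] = refl
length-split P? (x ∷ xs) with P? x
... | yes _ = cong suc (length-split P? xs)
... | no _ = trans (cong suc (length-split P? xs)) (sym (+-suc _ _))

module _ {A B : Set} (_≟_ : DecidableEquality B) (key : A → B) where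

  fibre : B → List A → List A
  fibre b = filter (λ a → key a ≟ b)

  fibre-count : ∀ k ks xs → All (λ a → key a ∈ ks) xs →
    (∀ b → length (fibre b xs) ≤ k) → length xs ≤ k * length ks
  fibre-count k [] [] _ _ = z≤n
  fibre-count k [] (x ∷ xs) (() ∷ _) _
  fibre-count k (b ∷ ks) xs keys small = begin
      length xs                                  ≡⟨ length-split (λ a → key a ≟ b) xs ⟩
      length (fibre b xs) + length rest          ≤⟨ +-mono-≤ (small b) rest-bound ⟩
      k + k * length ks                          ≡⟨ sym (*-suc k (length ks)) ⟩
      k * suc (length ks)                        ∎
    where
      open ≤-Reasoning
      rest : List A
      rest = filter (λ a → ¬? (key a ≟ b)) xs
      key-in-rest : ∀ {a} → a ∈ xs × key a ≢ b → key a ∈ ks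
      key-in-rest (a∈xs , a≢b) with All.lookup keys a∈xs
      ... | here e = contradiction e a≢b
      ... | there e = e
      rest-keys : All (λ a → key a ∈ ks) rest
      rest-keys = All.tabulate λ a∈rest → key-in-rest (∈-filter⁻ _ a∈rest)
      -- the fibres of rest are sublists of those of xs
      rest-small : ∀ c → length (fibre c rest) ≤ k
      rest-small c = ≤-trans
        (Sublist.length-mono-≤ (Sublist.filter⁺ _ _ (λ { refl q → q }) (Sublist.filter-⊆ _ xs)))
        (small c)
      rest-bound : length rest ≤ k * length ks
      rest-bound = fibre-count k ks rest rest-keys rest-small

unique-occurrences : ∀ {A : Set} (_≟_ : DecidableEquality A) {xs : List A} → Unique xs →
  ∀ b → length (fibre _≟_ (λ a → a) b xs) ≤ 1
unique-occurrences _≟_ [] b = z≤n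
unique-occurrences _≟_ {x ∷ xs} (x∉xs ∷ unique) b with x ≟ b
... | yes refl = s≤s (≤-reflexive (cong length (filter-none (_≟ x) (All.map (λ x≢a a≡x → x≢a (sym a≡x)) x∉xs))))
... | no _ = unique-occurrences _≟_ unique b

unique-pigeonhole : ∀ {A : Set} (_≟_ : DecidableEquality A) {xs ys : List A} → Unique xs →
  All (_∈ ys) xs → length xs ≤ length ys
unique-pigeonhole _≟_ {xs} {ys} unique inside =
  ≤-trans (fibre-count _≟_ (λ a → a) 1 ys xs inside (unique-occurrences _≟_ unique))
          (≤-reflexive (*-identityˡ (length ys)))

-- A nonempty duplicate-free list of positive numbers contains a number at least as
-- large as its length (otherwise it would fit into {1, …, length - 1}).
large-element : ∀ {xs : List ℕ} → Unique xs → All (1 ≤_) xs → 1 ≤ length xs → Any (length xs ≤_) xs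
large-element {x ∷ xs} unique positive _ with Any.any? (suc (length xs) ≤?_) (x ∷ xs)
... | yes large = large
... | no none = contradiction fits 1+n≰n
  where
    L : ℕ
    L = length xs
    in-range : ∀ {y} → 1 ≤ y × ¬ suc L ≤ y → y ∈ applyUpTo suc L
    in-range {suc y} (_ , small) = ∈-applyUpTo⁺ suc (s≤s⁻¹ (≰⇒> small))
    fits : suc L ≤ L
    fits = ≤-trans (unique-pigeonhole _≟_ unique (All.map in-range (All.zip (positive , ¬Any⇒All¬ _ none))))
                   (≤-reflexive (length-applyUpTo suc L))

unique-lookup-injective : ∀ {A : Set} {xs : List A} → Unique xs →
  ∀ {i j} → lookup xs i ≡ lookup xs j → i ≡ j
unique-lookup-injective (x∉xs ∷ _) {fzero} {fzero} _ = refl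
unique-lookup-injective (x∉xs ∷ _) {fzero} {fsuc j} e = contradiction e (All.lookup x∉xs (∈-lookup j))
unique-lookup-injective (x∉xs ∷ _) {fsuc i} {fzero} e = contradiction (sym e) (All.lookup x∉xs (∈-lookup i))
unique-lookup-injective (_ ∷ unique) {fsuc i} {fsuc j} e = cong fsuc (unique-lookup-injective unique e)

∃<? : ∀ {P : ℕ → Set} → (∀ j → Dec (P j)) → ∀ m → Dec (∃[ j ] (j < m × P j))
∃<? P? zero = no λ { (_ , () , _) }
∃<? {P} P? (suc m) with P? m | ∃<? P? m
... | yes Pm | _ = yes (m , ≤-refl , Pm)
... | no _ | yes (j , j<m , Pj) = yes (j , m<n⇒m<1+n j<m , Pj)
... | no ¬Pm | no none = no below
  where
    below : ¬ (∃[ j ] (j < suc m × P j))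
    below (j , j<1+m , Pj) with m≤n⇒m<n∨m≡n (s≤s⁻¹ j<1+m)
    ... | inj₁ j<m = none (j , j<m , Pj)
    ... | inj₂ refl = ¬Pm Pj

-- least P? k is the first j ≤ k with P j, and k if there is none.
least : ∀ {P : ℕ → Set} → (∀ j → Dec (P j)) → ℕ → ℕ
least P? zero = zero
least P? (suc k) with P? zero
... | yes _ = zero
... | no _ = suc (least (λ j → P? (suc j)) k)

least-≤ : ∀ {P : ℕ → Set} (P? : ∀ j → Dec (P j)) {k j} → P j → least P? k ≤ j
least-≤ P? {zero} _ = z≤n
least-≤ P? {suc k} {j} Pj with P? zero
least-≤ P? {suc k} {j} Pj | yes _ = z≤n
least-≤ P? {suc k} {zero} P0 | no ¬P0 = contradiction P0 ¬P0
least-≤ P? {suc k} {suc j} Pj | no _ = s≤s (least-≤ (λ i → P? (suc i)) {k} Pj)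

least-holds : ∀ {P : ℕ → Set} (P? : ∀ j → Dec (P j)) {k j} → P j → j ≤ k → P (least P? k)
least-holds P? {zero} P0 z≤n = P0
least-holds P? {suc k} {j} Pj j≤ with P? zero
least-holds P? {suc k} {j} Pj j≤ | yes P0 = P0
least-holds P? {suc k} {zero} P0 j≤ | no ¬P0 = contradiction P0 ¬P0
least-holds P? {suc k} {suc j} Pj j≤ | no _ = least-holds (λ i → P? (suc i)) {k} Pj (s≤s⁻¹ j≤)

least-minimal : ∀ {P : ℕ → Set} (P? : ∀ j → Dec (P j)) {k i} → i < least P? k → ¬ P i
least-minimal P? {suc k} {i} i< with P? zero
least-minimal P? {suc k} {zero} i< | no ¬P0 = ¬P0
least-minimal P? {suc k} {suc i} i< | no _ = least-minimal (λ j → P? (suc j)) {k} (s≤s⁻¹ i<)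

-- Adjacency of positions a and b on a cycle of length k (positions read as numbers);
-- at a = toℕ i, b = toℕ j this is exactly CycAdj k i j.
Consecutive : ℕ → ℕ → ℕ → Set
Consecutive k a b = (b ≡ suc a) ⊎ (a ≡ suc b) ⊎ ((a ≡ 0 × suc b ≡ k) ⊎ (b ≡ 0 × suc a ≡ k))

consecutive-sym : ∀ {k a b} → Consecutive k a b → Consecutive k b a
consecutive-sym (inj₁ e) = inj₂ (inj₁ e)
consecutive-sym (inj₂ (inj₁ e)) = inj₁ e
consecutive-sym (inj₂ (inj₂ (inj₁ e))) = inj₂ (inj₂ (inj₂ e))
consecutive-sym (inj₂ (inj₂ (inj₂ e))) = inj₂ (inj₂ (inj₁ e))

_◂_ : ∀ {A : Set} → A → (ℕ → A) → ℕ → A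
(w ◂ p) zero = w
(w ◂ p) (suc j) = p j

close : ∀ {A : Set} → (ℕ → A) → ℕ → A → ℕ → A
close p ℓ u i with i ≤? ℓ
... | yes _ = p i
... | no _ = u

close-on-path : ∀ {A : Set} {p : ℕ → A} {ℓ u i} → i ≤ ℓ → close p ℓ u i ≡ p i
close-on-path {ℓ = ℓ} {i = i} i≤ℓ with i ≤? ℓ
... | yes _ = refl
... | no i≰ℓ = contradiction i≤ℓ i≰ℓ

close-apex : ∀ {A : Set} {p : ℕ → A} {ℓ u} → close p ℓ u (suc ℓ) ≡ u
close-apex {ℓ = ℓ} with suc ℓ ≤? ℓ
... | yes 1+ℓ≤ℓ = contradiction 1+ℓ≤ℓ 1+n≰n
... | no _ = refl

data Slot (ℓ : ℕ) : ℕ → Set where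
  on-path : ∀ {i} → i ≤ ℓ → Slot ℓ i
  apex    : Slot ℓ (suc ℓ)

slot : ∀ {ℓ i} → i < 2 + ℓ → Slot ℓ i
slot (s≤s i≤1+ℓ) with m≤n⇒m<n∨m≡n i≤1+ℓ
... | inj₁ (s≤s i≤ℓ) = on-path i≤ℓ
... | inj₂ refl = apex

module _ (G : Graph) where

  Vertex : Set
  Vertex = Fin (n G)

  adj-sym : ∀ {a b : Vertex} → Adj G a b → Adj G b a
  adj-sym {a} {b} a~b = trans (Graph.sym G b a) a~b

  adj-irrefl : ∀ {a : Vertex} → ¬ Adj G a a
  adj-irrefl {a} a~a with trans (sym a~a) (Graph.irrefl G a)
  ... | ()

  adj⇒≢ : ∀ {a b : Vertex} → Adj G a b → a ≢ b
  adj⇒≢ a~b refl = adj-irrefl a~b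

  adj? : ∀ (a b : Vertex) → Dec (Adj G a b)
  adj? a b = adj G a b Bool.≟ true

  neighbours : Vertex → List Vertex
  neighbours v = filter (adj? v) (allFin (n G))

  neighbours-unique : ∀ v → Unique (neighbours v)
  neighbours-unique v = Unique.filter⁺ (adj? v) (allFin⁺ (n G))

  ∈-neighbours : ∀ {v u} → u ∈ neighbours v → Adj G v u
  ∈-neighbours {v} u∈ = proj₂ (∈-filter⁻ (adj? v) {xs = allFin (n G)} u∈)

  common-neighbours⇒K2t : ∀ {t} {a b : Vertex} {xs : List Vertex} → a ≢ b → Unique xs →
    All (λ u → Adj G a u × Adj G b u) xs → t ≤ length xs → ContainsK2t G t
  common-neighbours⇒K2t {t} {a} {b} {xs} a≢b unique common t≤ = embed , embed-injective , embed-adj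
    where
      leaf : Fin t → Vertex
      leaf j = lookup xs (inject≤ j t≤)
      leaf-common : ∀ j → Adj G a (leaf j) × Adj G b (leaf j)
      leaf-common j = All.lookup common (∈-lookup (inject≤ j t≤))
      embed : Fin 2 ⊎ Fin t → Vertex
      embed (inj₁ fzero) = a
      embed (inj₁ (fsuc _)) = b
      embed (inj₂ j) = leaf j
      embed-injective : Injective _≡_ _≡_ embed
      embed-injective {inj₁ fzero} {inj₁ fzero} _ = refl
      embed-injective {inj₁ fzero} {inj₁ (fsuc fzero)} e = contradiction e a≢b
      embed-injective {inj₁ (fsuc fzero)} {inj₁ fzero} e = contradiction (sym e) a≢b
      embed-injective {inj₁ (fsuc fzero)} {inj₁ (fsuc fzero)} _ = refl
      embed-injective {inj₁ fzero} {inj₂ j} e = contradiction e (adj⇒≢ (proj₁ (leaf-common j)))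
      embed-injective {inj₁ (fsuc fzero)} {inj₂ j} e = contradiction e (adj⇒≢ (proj₂ (leaf-common j)))
      embed-injective {inj₂ j} {inj₁ fzero} e = contradiction (sym e) (adj⇒≢ (proj₁ (leaf-common j)))
      embed-injective {inj₂ j} {inj₁ (fsuc fzero)} e = contradiction (sym e) (adj⇒≢ (proj₂ (leaf-common j)))
      embed-injective {inj₂ i} {inj₂ j} e =
        cong inj₂ (inject≤-injective t≤ t≤ i j (unique-lookup-injective unique e))
      embed-adj : ∀ (i : Fin 2) (j : Fin t) → Adj G (embed (inj₁ i)) (embed (inj₂ j))
      embed-adj fzero j = proj₁ (leaf-common j)
      embed-adj (fsuc fzero) j = proj₂ (leaf-common j)

  record InducedPath (p : ℕ → Vertex) (m : ℕ) : Set where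
    field
      distinct  : ∀ {a b} → a ≤ m → b ≤ m → p a ≡ p b → a ≡ b
      edge      : ∀ {a} → a < m → Adj G (p a) (p (suc a))
      chordless : ∀ {a b} → a ≤ m → b ≤ m → Adj G (p a) (p b) → b ≡ suc a ⊎ a ≡ suc b

  truncate : ∀ {p m ℓ} → ℓ ≤ m → InducedPath p m → InducedPath p ℓ
  truncate ℓ≤m P = record
    { distinct  = λ a≤ℓ b≤ℓ → distinct (≤-trans a≤ℓ ℓ≤m) (≤-trans b≤ℓ ℓ≤m)
    ; edge      = λ a<ℓ → edge (<-≤-trans a<ℓ ℓ≤m)
    ; chordless = λ a≤ℓ b≤ℓ → chordless (≤-trans a≤ℓ ℓ≤m) (≤-trans b≤ℓ ℓ≤m)
    }
    where open InducedPath P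

  path-length : ∀ {p m} → InducedPath p m → suc m ≤ n G
  path-length {p} {m} P = injective⇒≤ {f = λ i → p (toℕ i)} λ {i} {j} e →
      toℕ-injective (distinct (position i) (position j) e)
    where
      open InducedPath P
      position : (i : Fin (suc m)) → toℕ i ≤ m
      position i = s≤s⁻¹ (toℕ<n i)

  induced-cycle : ∀ {k} → 3 ≤ k → (q : ℕ → Vertex) →
    (∀ {a b} → a < k → b < k → q a ≡ q b → a ≡ b) →
    (∀ {a b} → a < k → b < k → Adj G (q a) (q b) → Consecutive k a b) →
    (∀ {a b} → a < k → b < k → Consecutive k a b → Adj G (q a) (q b)) →
    HasInducedCycle G k
  induced-cycle 3≤k q distinct adj⇒consecutive consecutive⇒adj =
    3≤k , (λ i → q (toℕ i)) ,
    (λ {i} {j} e → toℕ-injective (distinct (toℕ<n i) (toℕ<n j) e)) ,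
    λ i j → mk⇔ (adj⇒consecutive (toℕ<n i) (toℕ<n j)) (consecutive⇒adj (toℕ<n i) (toℕ<n j))

  module Closing {p : ℕ → Vertex} {ℓ : ℕ} {u : Vertex} (P : InducedPath p ℓ)
    (off : ∀ {j} → j ≤ ℓ → p j ≢ u) (u~start : Adj G u (p 0)) (u~end : Adj G u (p ℓ))
    (no-chord : ∀ {j} → suc j < ℓ → ¬ Adj G u (p (suc j))) where

    open InducedPath P

    q : ℕ → Vertex
    q = close p ℓ u

    q-on-path : ∀ {i} → i ≤ ℓ → q i ≡ p i
    q-on-path = close-on-path {p = p} {u = u}

    q-apex : q (suc ℓ) ≡ u
    q-apex = close-apex {p = p} {ℓ = ℓ}

    vertex : ∀ {i} → Slot ℓ i → Vertex
    vertex (on-path {i} _) = p i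
    vertex apex = u

    q-vertex : ∀ {i} (s : Slot ℓ i) → q i ≡ vertex s
    q-vertex (on-path i≤ℓ) = q-on-path i≤ℓ
    q-vertex apex = q-apex

    same-slot : ∀ {a b} (sa : Slot ℓ a) (sb : Slot ℓ b) → vertex sa ≡ vertex sb → a ≡ b
    same-slot (on-path a≤ℓ) (on-path b≤ℓ) e = distinct a≤ℓ b≤ℓ e
    same-slot (on-path a≤ℓ) apex e = contradiction e (off a≤ℓ)
    same-slot apex (on-path b≤ℓ) e = contradiction (sym e) (off b≤ℓ)
    same-slot apex apex _ = refl

    q-distinct : ∀ {a b} → a < 2 + ℓ → b < 2 + ℓ → q a ≡ q b → a ≡ b
    q-distinct a< b< e =
      same-slot (slot a<) (slot b<) (trans (sym (q-vertex (slot a<))) (trans e (q-vertex (slot b<))))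

    apex-neighbour : ∀ {j} → j ≤ ℓ → Adj G u (p j) → Consecutive (2 + ℓ) j (suc ℓ)
    apex-neighbour {zero} _ _ = inj₂ (inj₂ (inj₁ (refl , refl)))
    apex-neighbour {suc j} j≤ℓ u~pj with m≤n⇒m<n∨m≡n j≤ℓ
    ... | inj₁ j<ℓ = contradiction u~pj (no-chord j<ℓ)
    ... | inj₂ refl = inj₁ refl

    adjacent-slots : ∀ {a b} (sa : Slot ℓ a) (sb : Slot ℓ b) →
      Adj G (vertex sa) (vertex sb) → Consecutive (2 + ℓ) a b
    adjacent-slots (on-path a≤ℓ) (on-path b≤ℓ) h with chordless a≤ℓ b≤ℓ h
    ... | inj₁ e = inj₁ e
    ... | inj₂ e = inj₂ (inj₁ e)
    adjacent-slots (on-path a≤ℓ) apex h = apex-neighbour a≤ℓ (adj-sym h)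
    adjacent-slots apex (on-path b≤ℓ) h = consecutive-sym (apex-neighbour b≤ℓ h)
    adjacent-slots apex apex h = contradiction h adj-irrefl

    q-adj⇒consecutive : ∀ {a b} → a < 2 + ℓ → b < 2 + ℓ → Adj G (q a) (q b) → Consecutive (2 + ℓ) a b
    q-adj⇒consecutive a< b< h =
      adjacent-slots (slot a<) (slot b<) (subst₂ (Adj G) (q-vertex (slot a<)) (q-vertex (slot b<)) h)

    step : ∀ {a} → a < suc ℓ → Adj G (q a) (q (suc a))
    step a<1+ℓ with m≤n⇒m<n∨m≡n (s≤s⁻¹ a<1+ℓ)
    ... | inj₁ a<ℓ = subst₂ (Adj G) (sym (q-on-path (<⇒≤ a<ℓ))) (sym (q-on-path a<ℓ)) (edge a<ℓ)
    ... | inj₂ refl = subst₂ (Adj G) (sym (q-on-path ≤-refl)) (sym q-apex) (adj-sym u~end)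

    wrap : Adj G (q 0) (q (suc ℓ))
    wrap = subst₂ (Adj G) (sym (q-on-path z≤n)) (sym q-apex) (adj-sym u~start)

    consecutive⇒q-adj : ∀ {a b} → a < 2 + ℓ → b < 2 + ℓ → Consecutive (2 + ℓ) a b → Adj G (q a) (q b)
    consecutive⇒q-adj a< b< (inj₁ refl) = step (s≤s⁻¹ b<)
    consecutive⇒q-adj a< b< (inj₂ (inj₁ refl)) = adj-sym (step (s≤s⁻¹ a<))
    consecutive⇒q-adj a< b< (inj₂ (inj₂ (inj₁ (refl , e)))) rewrite suc-injective e = wrap
    consecutive⇒q-adj a< b< (inj₂ (inj₂ (inj₂ (refl , e)))) rewrite suc-injective e = adj-sym wrap

  close-path : ∀ {p ℓ u} → 1 ≤ ℓ → InducedPath p ℓ → (∀ {j} → j ≤ ℓ → p j ≢ u) →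
    Adj G u (p 0) → Adj G u (p ℓ) → (∀ {j} → suc j < ℓ → ¬ Adj G u (p (suc j))) →
    HasInducedCycle G (2 + ℓ)
  close-path 1≤ℓ P off u~start u~end no-chord =
    induced-cycle (s≤s (s≤s 1≤ℓ)) q q-distinct q-adj⇒consecutive consecutive⇒q-adj
    where open Closing P off u~start u~end no-chord

  trivial-path : ∀ v → InducedPath (λ _ → v) 0
  trivial-path v = record
    { distinct  = λ { z≤n z≤n _ → refl }
    ; edge      = λ ()
    ; chordless = λ _ _ v~v → contradiction v~v adj-irrefl
    }

  OnPath : (ℕ → Vertex) → ℕ → Vertex → Set
  OnPath p m w = ∃[ j ] (j ≤ m × p j ≡ w)

  SeesTail : (ℕ → Vertex) → ℕ → Vertex → Set
  SeesTail p m w = ∃[ j ] (j < m × Adj G w (p (suc j)))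

  Extends : (ℕ → Vertex) → ℕ → Vertex → Set
  Extends p m w = Adj G (p 0) w × ¬ OnPath p m w × ¬ SeesTail p m w

  Maximal : (ℕ → Vertex) → ℕ → Set
  Maximal p m = ∀ w → Adj G (p 0) w → OnPath p m w ⊎ SeesTail p m w

  on-path? : ∀ p m w → Dec (OnPath p m w)
  on-path? p m w = map′ (λ { (j , j<1+m , e) → j , s≤s⁻¹ j<1+m , e })
                        (λ { (j , j≤m , e) → j , s≤s j≤m , e })
                        (∃<? (λ j → p j ≟ᶠ w) (suc m))

  sees-tail? : ∀ p m w → Dec (SeesTail p m w)
  sees-tail? p m w = ∃<? (λ j → adj? w (p (suc j))) m

  extends? : ∀ p m w → Dec (Extends p m w)
  extends? p m w = adj? (p 0) w ×-dec ¬? (on-path? p m w) ×-dec ¬? (sees-tail? p m w)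

  extend : ∀ {p m w} → InducedPath p m → Extends p m w → InducedPath (w ◂ p) (suc m)
  extend {p} {m} {w} P (p₀~w , off , blind) = record
    { distinct = distinct′ ; edge = edge′ ; chordless = chordless′ }
    where
      open InducedPath P
      distinct′ : ∀ {a b} → a ≤ suc m → b ≤ suc m → (w ◂ p) a ≡ (w ◂ p) b → a ≡ b
      distinct′ {zero} {zero} _ _ _ = refl
      distinct′ {zero} {suc b} _ b≤ e = contradiction (b , s≤s⁻¹ b≤ , sym e) off
      distinct′ {suc a} {zero} a≤ _ e = contradiction (a , s≤s⁻¹ a≤ , e) off
      distinct′ {suc a} {suc b} a≤ b≤ e = cong suc (distinct (s≤s⁻¹ a≤) (s≤s⁻¹ b≤) e)
      edge′ : ∀ {a} → a < suc m → Adj G ((w ◂ p) a) ((w ◂ p) (suc a))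
      edge′ {zero} _ = adj-sym p₀~w
      edge′ {suc a} a< = edge (s≤s⁻¹ a<)
      chordless′ : ∀ {a b} → a ≤ suc m → b ≤ suc m → Adj G ((w ◂ p) a) ((w ◂ p) b) →
        b ≡ suc a ⊎ a ≡ suc b
      chordless′ {zero} {zero} _ _ h = contradiction h adj-irrefl
      chordless′ {zero} {suc zero} _ _ _ = inj₁ refl
      chordless′ {zero} {suc (suc b)} _ b≤ h = contradiction (b , s≤s⁻¹ b≤ , h) blind
      chordless′ {suc zero} {zero} _ _ _ = inj₂ refl
      chordless′ {suc (suc a)} {zero} a≤ _ h = contradiction (a , s≤s⁻¹ a≤ , adj-sym h) blind
      chordless′ {suc a} {suc b} a≤ b≤ h with chordless (s≤s⁻¹ a≤) (s≤s⁻¹ b≤) h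
      ... | inj₁ e = inj₁ (cong suc e)
      ... | inj₂ e = inj₂ (cong suc e)

  record MaximalPath : Set where
    field
      p       : ℕ → Vertex
      m       : ℕ
      induced : InducedPath p m
      maximal : Maximal p m

  stuck⇒maximal : ∀ {p m} → ¬ ∃ (Extends p m) → Maximal p m
  stuck⇒maximal {p} {m} stuck w p₀~w with on-path? p m w | sees-tail? p m w
  ... | yes on | _ = inj₁ on
  ... | no _ | yes sees = inj₂ sees
  ... | no off | no blind = contradiction (w , p₀~w , off , blind) stuck

  -- Prolong an induced path at its start for as long as possible; the fuel bounds the
  -- number of remaining vertices, so running out of fuel while still growing is absurd.
  grow : ∀ fuel {p m} → InducedPath p m → n G ≤ suc m + fuel → MaximalPath
  grow fuel {p} {m} P room with any? (extends? p m)
  ... | no stuck = record { p = p ; m = m ; induced = P ; maximal = stuck⇒maximal stuck }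
  ... | yes (w , ext) with fuel
  ...   | zero = contradiction (≤-trans (path-length (extend P ext)) (≤-trans room (≤-reflexive (+-identityʳ (suc m))))) 1+n≰n
  ...   | suc fuel′ = grow fuel′ (extend P ext) (≤-trans room (≤-reflexive (+-suc (suc m) fuel′)))

  maximal-path : Vertex → MaximalPath
  maximal-path v = grow (n G) (trivial-path v) (n≤1+n (n G))

  module Contacts (M : MaximalPath) where
    open MaximalPath M
    open InducedPath induced

    x : Vertex
    x = p 0

    far : List Vertex
    far = filter (λ u → ¬? (u ≟ᶠ p 1)) (neighbours x)

    far-unique : Unique far
    far-unique = Unique.filter⁺ _ (neighbours-unique x)

    degree-bound : degree G x ≤ 1 + length far
    degree-bound = begin
      length (neighbours x)                                 ≡⟨ length-split (_≟ᶠ p 1) (neighbours x) ⟩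
      length (fibre _≟ᶠ_ (λ u → u) (p 1) (neighbours x)) + length far
        ≤⟨ +-monoˡ-≤ (length far) (unique-occurrences _≟ᶠ_ (neighbours-unique x) (p 1)) ⟩
      1 + length far                                        ∎
      where open ≤-Reasoning

    far-member : ∀ {u} → u ∈ far → u ∈ neighbours x × u ≢ p 1
    far-member = ∈-filter⁻ _ {xs = neighbours x}

    far-adj : ∀ {u} → u ∈ far → Adj G x u
    far-adj u∈ = ∈-neighbours (proj₁ (far-member u∈))

    -- far neighbours are off the path, since x sees no path vertex but p₁
    far-off : ∀ {u} → u ∈ far → ∀ {j} → j ≤ m → p j ≢ u
    far-off u∈ {zero} _ refl = adj-irrefl (far-adj u∈)
    far-off u∈ {suc zero} _ e = proj₂ (far-member u∈) (sym e)
    far-off u∈ {suc (suc j)} j≤m refl with chordless z≤n j≤m (far-adj u∈)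
    ... | inj₁ ()
    ... | inj₂ ()

    far-sees-tail : ∀ {u} → u ∈ far → SeesTail p m u
    far-sees-tail {u} u∈ with maximal u (far-adj u∈)
    ... | inj₁ (j , j≤m , e) = contradiction e (far-off u∈ j≤m)
    ... | inj₂ sees = sees

    sees? : ∀ u j → Dec (Adj G u (p (suc j)))
    sees? u j = adj? u (p (suc j))

    contact : Vertex → ℕ
    contact u = suc (least (sees? u) m)

    contact-≤ : ∀ {u} → u ∈ far → contact u ≤ m
    contact-≤ {u} u∈ with far-sees-tail u∈
    ... | j , j<m , u~pj = ≤-trans (s≤s (least-≤ (sees? u) {m} u~pj)) j<m

    contact-adj : ∀ {u} → u ∈ far → Adj G u (p (contact u))
    contact-adj {u} u∈ with far-sees-tail u∈
    ... | j , j<m , u~pj = least-holds (sees? u) {m} u~pj (<⇒≤ j<m)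

    contact-first : ∀ {u j} → suc j < contact u → ¬ Adj G u (p (suc j))
    contact-first {u} j< = least-minimal (sees? u) {m} (s≤s⁻¹ j<)

    x≢contact : ∀ {u} → u ∈ far → x ≢ p (contact u)
    x≢contact u∈ e with distinct z≤n (contact-≤ u∈) e
    ... | ()

    contact-cycle : ∀ {u} → u ∈ far → HasInducedCycle G (2 + contact u)
    contact-cycle u∈ =
      close-path (s≤s z≤n) (truncate (contact-≤ u∈) induced)
        (λ j≤ → far-off u∈ (≤-trans j≤ (contact-≤ u∈)))
        (adj-sym (far-adj u∈)) (contact-adj u∈) contact-first

    -- The far neighbours with contact ℓ are common neighbours of x and p_ℓ, so in a
    -- K_{2,k+1}-free graph there are at most k of them.
    contact-fibre : ∀ {k} → K2tFree G (suc k) → ∀ ℓ → length (fibre _≟_ contact ℓ far) ≤ k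
    contact-fibre {k} free ℓ = ≮⇒≥ λ k<|F| →
        free (common-neighbours⇒K2t (x≢pℓ k<|F|) (Unique.filter⁺ _ far-unique) common k<|F|)
      where
        F : List Vertex
        F = fibre _≟_ contact ℓ far
        member : ∀ {u} → u ∈ F → u ∈ far × contact u ≡ ℓ
        member = ∈-filter⁻ _
        common : All (λ u → Adj G x u × Adj G (p ℓ) u) F
        common = All.tabulate λ u∈ →
          far-adj (proj₁ (member u∈)) ,
          subst (λ i → Adj G (p i) _) (proj₂ (member u∈)) (adj-sym (contact-adj (proj₁ (member u∈))))
        x≢pℓ : k < length F → x ≢ p ℓ
        x≢pℓ k<|F| = subst (λ i → x ≢ p i) (proj₂ (member u∈F)) (x≢contact (proj₁ (member u∈F)))
          where
            first : Fin (length F)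
            first = fromℕ< (≤-trans (s≤s z≤n) k<|F|)
            u∈F : lookup F first ∈ F
            u∈F = ∈-lookup first

    contacts : List ℕ
    contacts = deduplicate _≟_ (map contact far)

    contacts-unique : Unique contacts
    contacts-unique = deduplicate-! _≟_ (map contact far)

    contacts-cycles : All (λ ℓ → 1 ≤ ℓ × HasInducedCycle G (2 + ℓ)) contacts
    contacts-cycles = All.tabulate λ ℓ∈ → cycle (∈-map⁻ contact (∈-deduplicate⁻ _≟_ (map contact far) ℓ∈))
      where
        cycle : ∀ {ℓ} → ∃ (λ u → u ∈ far × ℓ ≡ contact u) → 1 ≤ ℓ × HasInducedCycle G (2 + ℓ)
        cycle (u , u∈ , refl) = s≤s z≤n , contact-cycle u∈

    degree-by-contacts : ∀ {k} → K2tFree G (suc k) → degree G x ≤ 1 + k * length contacts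
    degree-by-contacts {k} free = ≤-trans degree-bound (+-monoʳ-≤ 1
      (fibre-count _≟_ contact k contacts far
        (All.tabulate λ u∈ → ∈-deduplicate⁺ _≟_ (∈-map⁺ contact u∈)) (contact-fibre free)))

ceilDiv-≤ : ∀ {a b L} → a ≤ suc b * L → ceilDiv a (suc b) ≤ L
ceilDiv-≤ {a} {b} {L} a≤ = s≤s⁻¹ (m<n*o⇒m/o<n {a + b} {suc L} {suc b} (begin-strict
    a + b                  ≤⟨ +-monoˡ-≤ b a≤ ⟩
    suc b * L + b          <⟨ +-monoʳ-< (suc b * L) (n<1+n b) ⟩
    suc b * L + suc b      ≡⟨ +-comm (suc b * L) (suc b) ⟩
    suc b + suc b * L      ≡⟨ cong (suc b +_) (*-comm (suc b) L) ⟩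
    suc L * suc b          ∎))
  where open ≤-Reasoning

positive-factor : ∀ k {L} → 1 ≤ k * L → 1 ≤ L
positive-factor k {zero} 1≤k*0 = contradiction (≤-trans 1≤k*0 (≤-reflexive (*-zeroʳ k))) λ ()
positive-factor k {suc L} _ = s≤s z≤n

lemma13 : ∀ (t d : ℕ) → 2 ≤ t → 2 ≤ d → (G : Graph) →
    K2tFree G t → MinDegree G d →
    (Σ (List ℕ) λ ls → Unique ls × All (HasInducedCycle G) ls ×
        ceilDiv (d ∸ 1) (t ∸ 1) ≤ length ls)
    × (∃[ k ] (2 + ceilDiv (d ∸ 1) (t ∸ 1) ≤ k × HasInducedCycle G k))
lemma13 (suc zero) d (s≤s ()) _ _ _ _
lemma13 (suc (suc k′)) d _ 2≤d G free (min-degree , v , _) =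
    (map (2 +_) contacts , lengths-unique , lengths-cycles , many-lengths) ,
    (2 + ℓ , +-monoʳ-≤ 2 (≤-trans many-contacts (proj₂ longest-facts)) , proj₂ (proj₁ longest-facts))
  where
    open Contacts G (maximal-path G v)
    counted : d ∸ 1 ≤ suc k′ * length contacts
    counted = ∸-monoˡ-≤ 1 (≤-trans (min-degree x) (degree-by-contacts free))
    many-contacts : ceilDiv (d ∸ 1) (suc k′) ≤ length contacts
    many-contacts = ceilDiv-≤ counted
    many-lengths : ceilDiv (d ∸ 1) (suc k′) ≤ length (map (2 +_) contacts)
    many-lengths = ≤-trans many-contacts (≤-reflexive (sym (length-map (2 +_) contacts)))
    lengths-unique : Unique (map (2 +_) contacts)
    lengths-unique = Unique.map⁺ (λ e → suc-injective (suc-injective e)) contacts-unique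
    lengths-cycles : All (HasInducedCycle G) (map (2 +_) contacts)
    lengths-cycles = All.map⁺ (All.map proj₂ contacts-cycles)
    longest : Any (length contacts ≤_) contacts
    longest = large-element contacts-unique (All.map proj₁ contacts-cycles)
                (positive-factor (suc k′) (≤-trans (∸-monoˡ-≤ 1 2≤d) counted))
    ℓ : ℕ
    ℓ = Any.lookup longest
    longest-facts : (1 ≤ ℓ × HasInducedCycle G (2 + ℓ)) × length contacts ≤ ℓ
    longest-facts = All.lookupAny contacts-cycles longest
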